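{- Let $n \ge 1$, let $q$ be a prime power, and let $L$ be a set of at most $n+1$ projective lines in $\mathbb{F}_q P^n$ in general position, i.e. for every $k \in [n-1]$ no $k+1$ of the lines of $L$ are contained in a common $k$-flat. Then there exist a line $l \in L$ and (at most) two points $p, p' \in l$ such that $l \cap l' \subseteq \{p, p'\}$ for every $l' \in L \setminus \{l\}$.
   Context: $\mathbb{F}_q P^n$ is the $n$-dimensional projective space over $\mathbb{F}_q$ (points are $1$-dimensional linear subspaces of $\mathbb{F}_q^{n+1}$); a flat is the set of points contained in a linear subspace $U$ of $\mathbb{F}_q^{n+1}$, of dimension $\dim U - 1$; a $k$-flat has dimension $k$, and projective lines are $1$-flats. $[n-1]=\{1,\dots,n-1\}$. -}

module Defs where

open import Level using (Level; _⊔_)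
open import Algebra.Bundles using (CommutativeRing)
open import Data.Nat using (ℕ; zero; suc; _≤_; _^_)
open import Data.Nat.Primality using (Prime)
open import Data.Fin using (Fin; zero; suc)
open import Data.Product using (Σ; ∃; ∃-syntax; _×_; _,_)
open import Data.Sum using (_⊎_)
open import Relation.Nullary using (¬_)
open import Relation.Binary.PropositionalEquality using (_≡_)

IsPrimePower : ℕ → Set
IsPrimePower q = ∃[ p ] ∃[ k ] (Prime p × q ≡ p ^ suc k)

record Field (c ℓ : Level) : Set (Level.suc (c ⊔ ℓ)) where
  field
    commRing : CommutativeRing c ℓ
  open CommutativeRing commRing public
  field
    1≉0 : ¬ (1# ≈ 0#)
    inverse : ∀ x → ¬ (x ≈ 0#) → ∃[ y ] (x * y ≈ 1#)

HasCardinality : ∀ {c ℓ} → Field c ℓ → ℕ → Set (c ⊔ ℓ)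
HasCardinality F q =
  Σ (Fin q → Carrier) λ e →
    (∀ i j → e i ≈ e j → i ≡ j) × (∀ x → ∃[ i ] (e i ≈ x))
  where open Field F using (Carrier; _≈_)

module Projective {c ℓ} (F : Field c ℓ) (n : ℕ) where
  open Field F using (Carrier; _≈_; _+_; _*_; 0#)

  V : Set c
  V = Fin (suc n) → Carrier

  Σ' : ∀ {k} → (Fin k → Carrier) → Carrier
  Σ' {zero}  f = 0#
  Σ' {suc k} f = f zero + Σ' (λ i → f (suc i))

  comb : ∀ {k} → (Fin k → Carrier) → (Fin k → V) → V
  comb a w i = Σ' (λ j → a j * w j i)

  _≈v_ : V → V → Set ℓ
  u ≈v v = ∀ i → u i ≈ v i

  IsZero : V → Set ℓ
  IsZero v = ∀ i → v i ≈ 0#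

  NonZero : V → Set ℓ
  NonZero v = ¬ IsZero v

  InSpan : ∀ {k} → V → (Fin k → V) → Set (c ⊔ ℓ)
  InSpan v w = ∃[ a ] (v ≈v comb a w)

  LinIndep : ∀ {k} → (Fin k → V) → Set (c ⊔ ℓ)
  LinIndep w = ∀ a → IsZero (comb a w) → ∀ j → a j ≈ 0#

  -- a k-flat: the projectivisation of a (k+1)-dimensional subspace,
  -- given by a basis of k+1 vectors
  record Flat (k : ℕ) : Set (c ⊔ ℓ) where
    field
      basis : Fin (suc k) → V
      indep : LinIndep basis

  Line : Set (c ⊔ ℓ)
  Line = Flat 1

  open Flat public

  _∈ₛ_ : ∀ {k} → V → Flat k → Set (c ⊔ ℓ)
  v ∈ₛ A = InSpan v (basis A)

  -- a projective point (nonzero vector, up to scalars) lies on a flat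
  _∈ₚ_ : ∀ {k} → V → Flat k → Set (c ⊔ ℓ)
  p ∈ₚ A = NonZero p × p ∈ₛ A

  _⊆_ : ∀ {k m} → Flat k → Flat m → Set (c ⊔ ℓ)
  A ⊆ B = ∀ j → basis A j ∈ₛ B

  SameFlat : ∀ {k m} → Flat k → Flat m → Set (c ⊔ ℓ)
  SameFlat A B = A ⊆ B × B ⊆ A

  SamePoint : V → V → Set (c ⊔ ℓ)
  SamePoint u v = ∃[ a ] (u ≈v (λ i → a * v i))

  GeneralPosition : ∀ {m} → (Fin m → Line) → Set (c ⊔ ℓ)
  GeneralPosition {m} L =
    ∀ (k : ℕ) → 1 ≤ k → suc k ≤ n →
    (ι : Fin (suc k) → Fin m) → (∀ i j → ι i ≡ ι j → i ≡ j) →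
    ¬ (Σ (Flat k) λ P → ∀ i → L (ι i) ⊆ P)

-- Suppose every line met the others in at least three distinct points. Set one line L₀
-- aside; two distinct points of a line cannot both lie on L₀ (the lines are distinct), so
-- each remaining line meets the other remaining lines in two distinct points. Spanning the
-- remaining m − 1 lines greedily costs at most one vector per line on average, so they lie
-- in a subspace of dimension at most m − 1 ≤ n, i.e. k + 1 of them lie in a k-flat,
-- contradicting general position. Finiteness of F only serves to make the case
-- distinctions decidable.

module Submission where

open import Defs
open import Level using (Level; _⊔_)
open import Data.Nat using (ℕ; zero; suc; _≤_; _<_; z≤n; s≤s)
import Data.Nat as Nat
import Data.Nat.Properties as ℕₚ
open import Data.Fin using (Fin; inject≤) renaming (zero to fz; suc to fs)
open import Data.Fin.Properties using (inject≤-injective; suc-injective)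
import Data.Fin.Properties as Fin
open import Data.Vec.Functional using (Vector; head; tail) renaming ([] to []ᵛ; _∷_ to _∷ᵛ_)
open import Data.Product using (Σ; ∃; ∃-syntax; _×_; _,_; proj₁; proj₂)
open import Data.Sum using (_⊎_; inj₁; inj₂)
open import Data.List using (List; []; _∷_; length; filter; tabulate)
open import Data.List.Properties using (filter-notAll; length-tabulate)
open import Data.List.Relation.Unary.Any using (Any; here; there; any?)
open import Data.List.Relation.Unary.All as All using (All; []; _∷_)
open import Data.List.Relation.Unary.All.Properties using (¬Any⇒All¬)
open import Data.List.Membership.Propositional using (_∈_; find; lose)
open import Data.List.Membership.Propositional.Properties using (∈-filter⁺; ∈-filter⁻; ∈-tabulate⁺; ∈-tabulate⁻)
open import Data.Maybe using (Maybe; just; nothing)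
open import Function using (_∘_; case_of_)
open import Induction.WellFounded using (Acc; acc)
open import Data.Nat.Induction using (<-wellFounded)
open import Relation.Nullary using (¬_; Dec; yes; no)
open import Relation.Nullary.Decidable using (map′; ¬?; _×-dec_)
open import Data.Empty using (⊥; ⊥-elim)
open import Relation.Binary.PropositionalEquality using (_≡_)
import Relation.Binary.PropositionalEquality as ≡
open import Algebra.Bundles using (CommutativeRing)
open import Algebra.Solver.Ring.AlmostCommutativeRing using (fromCommutativeRing; _-Raw-AlmostCommutative⟶_)
open import Data.Integer.Base as ℤ using (ℤ; +_; -[1+_]; _⊖_)
import Data.Integer.Properties as ℤₚ

module IntegerCoefficientSolver {c ℓ} (CR : CommutativeRing c ℓ) where
  open CommutativeRing CR
  open import Algebra.Properties.Ring ring using (-0#≈0#; -‿distribˡ-*; -‿+-comm; -‿involutive)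
  open import Algebra.Properties.Semiring.Mult semiring using (×-homo-+; ×-homo-1) renaming (_×_ to _×ᵤ_)
  open import Relation.Binary.Reasoning.Setoid setoid

  ⟦_⟧ℤ : ℤ → Carrier
  ⟦ + n      ⟧ℤ = n ×ᵤ 1#
  ⟦ -[1+ n ] ⟧ℤ = - (suc n ×ᵤ 1#)

  private
    suc-minus-suc : ∀ x y → (1# + x) + - (1# + y) ≈ x + - y
    suc-minus-suc x y = begin
      (1# + x) + - (1# + y)    ≈⟨ +-cong (+-comm 1# x) (sym (-‿+-comm 1# y)) ⟩
      (x + 1#) + (- 1# + - y)  ≈⟨ +-assoc x 1# _ ⟩
      x + (1# + (- 1# + - y))  ≈⟨ +-cong refl (sym (+-assoc 1# _ _)) ⟩
      x + ((1# + - 1#) + - y)  ≈⟨ +-cong refl (+-cong (-‿inverseʳ 1#) refl) ⟩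
      x + (0# + - y)           ≈⟨ +-cong refl (+-identityˡ _) ⟩
      x + - y                  ∎

    ⊖-homo : ∀ m n → ⟦ m ⊖ n ⟧ℤ ≈ m ×ᵤ 1# + - (n ×ᵤ 1#)
    ⊖-homo m       zero    = sym (trans (+-cong refl -0#≈0#) (+-identityʳ _))
    ⊖-homo zero    (suc n) = sym (+-identityˡ _)
    ⊖-homo (suc m) (suc n) = begin
      ⟦ suc m ⊖ suc n ⟧ℤ                 ≡⟨ ≡.cong ⟦_⟧ℤ (ℤₚ.[1+m]⊖[1+n]≡m⊖n m n) ⟩
      ⟦ m ⊖ n ⟧ℤ                         ≈⟨ ⊖-homo m n ⟩
      m ×ᵤ 1# + - (n ×ᵤ 1#)                ≈⟨ suc-minus-suc _ _ ⟨
      suc m ×ᵤ 1# + - (suc n ×ᵤ 1#)        ∎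

    +-homo : ∀ i j → ⟦ i ℤ.+ j ⟧ℤ ≈ ⟦ i ⟧ℤ + ⟦ j ⟧ℤ
    +-homo (+ m)    (+ n)    = ×-homo-+ 1# m n
    +-homo (+ m)    -[1+ n ] = ⊖-homo m (suc n)
    +-homo -[1+ m ] (+ n)    = trans (⊖-homo n (suc m)) (+-comm _ _)
    +-homo -[1+ m ] -[1+ n ] = begin
      - (suc (suc (m Nat.+ n)) ×ᵤ 1#)       ≡⟨ ≡.cong (λ k → - (suc k ×ᵤ 1#)) (≡.sym (ℕₚ.+-suc m n)) ⟩
      - ((suc m Nat.+ suc n) ×ᵤ 1#)         ≈⟨ -‿cong (×-homo-+ 1# (suc m) (suc n)) ⟩
      - (suc m ×ᵤ 1# + suc n ×ᵤ 1#)          ≈⟨ -‿+-comm _ _ ⟨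
      - (suc m ×ᵤ 1#) + - (suc n ×ᵤ 1#)      ∎

    neg-homo : ∀ i → ⟦ ℤ.- i ⟧ℤ ≈ - ⟦ i ⟧ℤ
    neg-homo (+ zero)  = sym -0#≈0#
    neg-homo (+ suc n) = refl
    neg-homo -[1+ n ]  = sym (-‿involutive _)

    *-homo⁺ : ∀ m j → ⟦ + m ℤ.* j ⟧ℤ ≈ (m ×ᵤ 1#) * ⟦ j ⟧ℤ
    *-homo⁺ zero    j = sym (zeroˡ _)
    *-homo⁺ (suc m) j = begin
      ⟦ + suc m ℤ.* j ⟧ℤ                  ≡⟨ ≡.cong ⟦_⟧ℤ (ℤₚ.suc-* (+ m) j) ⟩
      ⟦ j ℤ.+ + m ℤ.* j ⟧ℤ                ≈⟨ +-homo j (+ m ℤ.* j) ⟩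
      ⟦ j ⟧ℤ + ⟦ + m ℤ.* j ⟧ℤ             ≈⟨ +-cong (sym (*-identityˡ _)) (*-homo⁺ m j) ⟩
      1# * ⟦ j ⟧ℤ + (m ×ᵤ 1#) * ⟦ j ⟧ℤ    ≈⟨ distribʳ _ _ _ ⟨
      (suc m ×ᵤ 1#) * ⟦ j ⟧ℤ              ∎

    *-homo : ∀ i j → ⟦ i ℤ.* j ⟧ℤ ≈ ⟦ i ⟧ℤ * ⟦ j ⟧ℤ
    *-homo (+ m)    j = *-homo⁺ m j
    *-homo -[1+ m ] j = begin
      ⟦ -[1+ m ] ℤ.* j ⟧ℤ                 ≡⟨ ≡.cong ⟦_⟧ℤ (ℤₚ.neg-distribˡ-* (+ suc m) j) ⟨
      ⟦ ℤ.- (+ suc m ℤ.* j) ⟧ℤ            ≈⟨ neg-homo (+ suc m ℤ.* j) ⟩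
      - ⟦ + suc m ℤ.* j ⟧ℤ                ≈⟨ -‿cong (*-homo⁺ (suc m) j) ⟩
      - ((suc m ×ᵤ 1#) * ⟦ j ⟧ℤ)          ≈⟨ -‿distribˡ-* _ _ ⟩
      - (suc m ×ᵤ 1#) * ⟦ j ⟧ℤ            ∎

  morphism : ℤ.+-*-rawRing -Raw-AlmostCommutative⟶ fromCommutativeRing CR
  morphism = record
    { ⟦_⟧ = ⟦_⟧ℤ ; +-homo = +-homo ; *-homo = *-homo ; -‿homo = neg-homo
    ; 0-homo = refl ; 1-homo = ×-homo-1 1# }

  coefficient-equality : ∀ i j → Maybe (⟦ i ⟧ℤ ≈ ⟦ j ⟧ℤ)
  coefficient-equality i j with i ℤₚ.≟ j
  ... | yes ≡.refl = just refl
  ... | no _       = nothing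

  open import Algebra.Solver.Ring ℤ.+-*-rawRing (fromCommutativeRing CR) morphism coefficient-equality public
    using (solve; _:=_; _:+_; _:*_; :-_; _:-_; con)

module FiniteField {c ℓ} (F : Field c ℓ) {q : ℕ} (card : HasCardinality F q) where
  open Field F using (Carrier; _≈_; refl; sym; trans)

  private
    enum : Fin q → Carrier
    enum = proj₁ card

    enum-injective : ∀ i j → enum i ≈ enum j → i ≡ j
    enum-injective = proj₁ (proj₂ card)

    enum-surjective : ∀ x → ∃[ i ] (enum i ≈ x)
    enum-surjective = proj₂ (proj₂ card)

  infix 4 _≟_
  _≟_ : ∀ x y → Dec (x ≈ y)
  x ≟ y with enum-surjective x | enum-surjective y
  ... | i , eᵢ≈x | j , eⱼ≈y with i Fin.≟ j
  ... | yes ≡.refl = yes (trans (sym eᵢ≈x) eⱼ≈y)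
  ... | no i≢j   = no λ x≈y → i≢j (enum-injective i j (trans eᵢ≈x (trans x≈y (sym eⱼ≈y))))

  ∃? : ∀ {p} (P : Carrier → Set p) → (∀ {x y} → x ≈ y → P x → P y) →
       (∀ x → Dec (P x)) → Dec (∃ P)
  ∃? P resp P? = map′ (λ (i , pᵢ) → enum i , pᵢ) from (Fin.any? (λ i → P? (enum i)))
    where
    from : ∃ P → ∃ λ i → P (enum i)
    from (x , px) = let i , eᵢ≈x = enum-surjective x in i , resp (sym eᵢ≈x) px

  ∃ⱽ? : ∀ {p} k (P : Vector Carrier k → Set p) →
        (∀ {a b} → (∀ i → a i ≈ b i) → P a → P b) →
        (∀ a → Dec (P a)) → Dec (∃ P)
  ∃ⱽ? zero P resp P? = map′ ([]ᵛ ,_) (λ (a , pa) → resp (λ ()) pa) (P? []ᵛ)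
  ∃ⱽ? (suc k) P resp P? =
    map′ (λ (x , a , pa) → x ∷ᵛ a , pa)
         (λ (a , pa) → head a , tail a , resp (λ { fz → refl ; (fs i) → refl }) pa)
         (∃? (λ x → ∃ λ a → P (x ∷ᵛ a))
             (λ x≈y (a , pa) → a , resp (λ { fz → x≈y ; (fs i) → refl }) pa)
             (λ x → ∃ⱽ? k (λ a → P (x ∷ᵛ a))
                        (λ a≈b → resp (λ { fz → refl ; (fs i) → a≈b i }))
                        (λ a → P? (x ∷ᵛ a))))

module Spans {c ℓ} (F : Field c ℓ) (n : ℕ) where
  open Field F
  open Projective F n
  open import Relation.Binary.Reasoning.Setoid setoid
  open IntegerCoefficientSolver commRing using (solve; _:=_; _:+_)

  Σ'-cong : ∀ {k} {f g : Fin k → Carrier} → (∀ i → f i ≈ g i) → Σ' f ≈ Σ' g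
  Σ'-cong {zero}  _ = refl
  Σ'-cong {suc k} f≈g = +-cong (f≈g fz) (Σ'-cong (f≈g ∘ fs))

  Σ'-zero : ∀ {k} {f : Fin k → Carrier} → (∀ i → f i ≈ 0#) → Σ' f ≈ 0#
  Σ'-zero {zero}  _ = refl
  Σ'-zero {suc k} f≈0 = trans (+-cong (f≈0 fz) (Σ'-zero (f≈0 ∘ fs))) (+-identityˡ 0#)

  Σ'-+ : ∀ {k} (f g : Fin k → Carrier) → Σ' f + Σ' g ≈ Σ' (λ i → f i + g i)
  Σ'-+ {zero}  f g = +-identityˡ 0#
  Σ'-+ {suc k} f g = trans (interchange _ _ _ _) (+-cong refl (Σ'-+ (f ∘ fs) (g ∘ fs)))
    where
    interchange : ∀ a b x y → (a + b) + (x + y) ≈ (a + x) + (b + y)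
    interchange = solve 4 (λ a b x y → (a :+ b) :+ (x :+ y) := (a :+ x) :+ (b :+ y)) refl

  *-distribˡ-Σ' : ∀ {k} s (f : Fin k → Carrier) → s * Σ' f ≈ Σ' (λ i → s * f i)
  *-distribˡ-Σ' {zero}  s f = zeroʳ s
  *-distribˡ-Σ' {suc k} s f = trans (distribˡ _ _ _) (+-cong refl (*-distribˡ-Σ' s (f ∘ fs)))

  comb-cong : ∀ {k} {a b : Vector Carrier k} (w : Fin k → V) → (∀ j → a j ≈ b j) → comb a w ≈v comb b w
  comb-cong {k} w a≈b i = Σ'-cong {k} (λ j → *-cong (a≈b j) refl)

  comb-zero : ∀ {k} {a : Vector Carrier k} (w : Fin k → V) → (∀ j → a j ≈ 0#) → IsZero (comb a w)
  comb-zero {k} w a≈0 i = trans (comb-cong w a≈0 i) (Σ'-zero {k} (λ j → zeroˡ _))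

  InSpan-resp : ∀ {k} {u v : V} (G : Fin k → V) → u ≈v v → InSpan u G → InSpan v G
  InSpan-resp G u≈v (a , u≈aG) = a , λ i → trans (sym (u≈v i)) (u≈aG i)

  InSpan-zero : ∀ {k} (G : Fin k → V) → InSpan (λ _ → 0#) G
  InSpan-zero G = (λ _ → 0#) , λ i → sym (comb-zero G (λ _ → refl) i)

  InSpan-+ : ∀ {k} {u v : V} (G : Fin k → V) → InSpan u G → InSpan v G → InSpan (λ i → u i + v i) G
  InSpan-+ {k} G (a , u≈aG) (b , v≈bG) = (λ j → a j + b j) , λ i → begin
    _                                      ≈⟨ +-cong (u≈aG i) (v≈bG i) ⟩
    comb a G i + comb b G i                ≈⟨ Σ'-+ {k} _ _ ⟩
    Σ' (λ j → a j * G j i + b j * G j i)   ≈⟨ Σ'-cong {k} (λ j → sym (distribʳ _ _ _)) ⟩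
    comb (λ j → a j + b j) G i             ∎

  InSpan-* : ∀ {k} {u : V} (G : Fin k → V) s → InSpan u G → InSpan (λ i → s * u i) G
  InSpan-* {k} G s (a , u≈aG) = (λ j → s * a j) , λ i → begin
    _                              ≈⟨ *-cong refl (u≈aG i) ⟩
    s * comb a G i                 ≈⟨ *-distribˡ-Σ' {k} s _ ⟩
    Σ' (λ j → s * (a j * G j i))   ≈⟨ Σ'-cong {k} (λ j → sym (*-assoc _ _ _)) ⟩
    comb (λ j → s * a j) G i       ∎

  InSpan-∷ : ∀ {k} {v : V} (G : Fin k → V) w → InSpan v G → InSpan v (w ∷ᵛ G)
  InSpan-∷ G w (a , v≈aG) =
    0# ∷ᵛ a , λ i → trans (v≈aG i) (trans (sym (+-identityˡ _)) (+-cong (sym (zeroˡ _)) refl))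

  InSpan-trans : ∀ {k g} {S : Fin k → V} {G : Fin g → V} →
                 (∀ j → InSpan (S j) G) → ∀ {v} → InSpan v S → InSpan v G
  InSpan-trans {zero} {G = G} _ (a , v≈aS) = InSpan-resp G (λ i → sym (v≈aS i)) (InSpan-zero G)
  InSpan-trans {suc k} {S = S} {G} S⊆G (a , v≈aS) =
    InSpan-resp G (λ i → sym (v≈aS i))
      (InSpan-+ G (InSpan-* G (head a) (S⊆G fz))
                  (InSpan-trans (S⊆G ∘ fs) (tail a , λ i → refl)))

  unit : ∀ {k} → Fin k → Vector Carrier k
  unit fz     fz     = 1#
  unit fz     (fs _) = 0#
  unit (fs j) fz     = 0#
  unit (fs j) (fs t) = unit j t

  comb-unit : ∀ {k} (G : Fin k → V) j → comb (unit j) G ≈v G j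
  comb-unit G fz     i = trans (+-cong (*-identityˡ _) (comb-zero (G ∘ fs) (λ _ → refl) i)) (+-identityʳ _)
  comb-unit G (fs j) i = trans (+-cong (zeroˡ _) (comb-unit (G ∘ fs) j i)) (+-identityˡ _)

  InSpan-member : ∀ {k} (G : Fin k → V) j → InSpan (G j) G
  InSpan-member G j = unit j , λ i → sym (comb-unit G j i)

  basis-nonZero : ∀ {k} (A : Flat k) j → NonZero (basis A j)
  basis-nonZero A j Aⱼ≈0 =
    1≉0 (trans (sym (unit-diagonal j)) (indep A (unit j) (λ i → trans (comb-unit (basis A) j i) (Aⱼ≈0 i)) j))
    where
    unit-diagonal : ∀ {k} (j : Fin k) → unit j j ≈ 1#
    unit-diagonal fz     = refl
    unit-diagonal (fs j) = unit-diagonal j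

module Geometry {c ℓ} (F : Field c ℓ) {q : ℕ} (card : HasCardinality F q) (n : ℕ) where
  open Field F
  open Projective F n
  open Spans F n
  open FiniteField F card
  open import Algebra.Properties.Ring ring using (x∙y⁻¹≈ε⇒x≈y)
  open import Relation.Binary.Reasoning.Setoid setoid
  open IntegerCoefficientSolver commRing using (solve; _:=_; _:+_; _:*_; :-_; _:-_; con)

  NonZero? : ∀ v → Dec (NonZero v)
  NonZero? v = ¬? (Fin.all? (λ i → v i ≟ 0#))

  SamePoint? : ∀ u v → Dec (SamePoint u v)
  SamePoint? u v = ∃? (λ a → u ≈v (λ i → a * v i)) (λ a≈b u≈av i → trans (u≈av i) (*-cong a≈b refl))
                      (λ a → Fin.all? (λ i → u i ≟ a * v i))

  InSpan? : ∀ {k} v (G : Fin k → V) → Dec (InSpan v G)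
  InSpan? {k} v G = ∃ⱽ? k (λ a → v ≈v comb a G) (λ a≈b v≈aG i → trans (v≈aG i) (comb-cong G a≈b i))
                        (λ a → Fin.all? (λ i → v i ≟ comb a G i))

  LinIndep-∷ : ∀ {k} {G : Fin k → V} {w : V} → LinIndep G → ¬ InSpan w G → LinIndep (w ∷ᵛ G)
  LinIndep-∷ {G = G} {w} G-indep w∉G a a[w∷G]≈0 with head a ≟ 0#
  ... | yes a₀≈0 = λ { fz → a₀≈0 ; (fs j) → G-indep (tail a) tail≈0 j }
    where
    tail≈0 : IsZero (comb (tail a) G)
    tail≈0 i = trans (sym (+-identityˡ _))
                     (trans (+-cong (sym (trans (*-cong a₀≈0 refl) (zeroˡ _))) refl) (a[w∷G]≈0 i))
  ... | no a₀≉0 with inverse (head a) a₀≉0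
  ... | y , a₀y≈1 = ⊥-elim (w∉G (InSpan-resp G (λ i → sym (isolate (w i) _ (a[w∷G]≈0 i)))
                                               (InSpan-* G (- y) (tail a , λ i → refl))))
    where
    isolate : ∀ x r → head a * x + r ≈ 0# → x ≈ (- y) * r
    isolate x r a₀x+r≈0 = begin
      x                                ≈⟨ sym (*-identityˡ x) ⟩
      1# * x                           ≈⟨ *-cong (sym a₀y≈1) refl ⟩
      (head a * y) * x                 ≈⟨ solve 4 (λ a y x r → (a :* y) :* x := y :* (a :* x :+ r) :+ (:- y) :* r)
                                                  refl (head a) y x r ⟩
      y * (head a * x + r) + (- y) * r ≈⟨ +-cong (trans (*-cong refl a₀x+r≈0) (zeroʳ y)) refl ⟩
      0# + (- y) * r                   ≈⟨ +-identityˡ _ ⟩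
      (- y) * r                        ∎

  independent-subfamily : ∀ {g} (G : Fin g → V) →
    ∃[ b ] Σ (Fin b → V) λ B → b ≤ g × LinIndep B × (∀ j → InSpan (G j) B)
  independent-subfamily {zero} G = 0 , []ᵛ , z≤n , (λ _ _ ()) , λ ()
  independent-subfamily {suc g} G with independent-subfamily (tail G)
  ... | b , B , b≤g , B-indep , tailG⊆B with InSpan? (head G) B
  ... | yes G₀∈B = b , B , ℕₚ.m≤n⇒m≤1+n b≤g , B-indep , λ { fz → G₀∈B ; (fs j) → tailG⊆B j }
  ... | no G₀∉B  = suc b , head G ∷ᵛ B , s≤s b≤g , LinIndep-∷ B-indep G₀∉B ,
                   λ { fz → InSpan-member (head G ∷ᵛ B) fz ; (fs j) → InSpan-∷ B (head G) (tailG⊆B j) }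

  infix 4 _⊆span_
  _⊆span_ : ∀ {k g} → Flat k → (Fin g → V) → Set (c ⊔ ℓ)
  A ⊆span G = ∀ j → InSpan (basis A j) G

  ⊆span-trans : ∀ {k g h} {A : Flat k} {G : Fin g → V} {H : Fin h → V} →
                A ⊆span G → (∀ j → InSpan (G j) H) → A ⊆span H
  ⊆span-trans A⊆G G⊆H j = InSpan-trans G⊆H (A⊆G j)

  private
    proportional-pivot : ∀ {α₀ α₁ β₀ β₁ s} → β₀ * s ≈ 1# → α₀ * β₁ ≈ α₁ * β₀ →
                         α₀ ≈ (α₀ * s) * β₀ × α₁ ≈ (α₀ * s) * β₁
    proportional-pivot {α₀} {α₁} {β₀} {β₁} {s} β₀s≈1 α₀β₁≈α₁β₀ =
      (begin
        α₀               ≈⟨ sym (*-identityʳ α₀) ⟩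
        α₀ * 1#          ≈⟨ *-cong refl (sym β₀s≈1) ⟩
        α₀ * (β₀ * s)    ≈⟨ solve 3 (λ α₀ β₀ s → α₀ :* (β₀ :* s) := (α₀ :* s) :* β₀) refl α₀ β₀ s ⟩
        (α₀ * s) * β₀    ∎) ,
      (begin
        α₁               ≈⟨ sym (*-identityʳ α₁) ⟩
        α₁ * 1#          ≈⟨ *-cong refl (sym β₀s≈1) ⟩
        α₁ * (β₀ * s)    ≈⟨ sym (*-assoc α₁ β₀ s) ⟩
        (α₁ * β₀) * s    ≈⟨ *-cong (sym α₀β₁≈α₁β₀) refl ⟩
        (α₀ * β₁) * s    ≈⟨ solve 3 (λ α₀ β₁ s → (α₀ :* β₁) :* s := (α₀ :* s) :* β₁) refl α₀ β₁ s ⟩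
        (α₀ * s) * β₁    ∎)

  proportional : ∀ {α₀ α₁ β₀ β₁} → α₀ * β₁ ≈ α₁ * β₀ → ¬ (β₀ ≈ 0# × β₁ ≈ 0#) →
                 ∃ λ a → α₀ ≈ a * β₀ × α₁ ≈ a * β₁
  proportional {β₀ = β₀} {β₁} α₀β₁≈α₁β₀ β≉0 with β₀ ≟ 0# | β₁ ≟ 0#
  ... | yes β₀≈0 | yes β₁≈0 = ⊥-elim (β≉0 (β₀≈0 , β₁≈0))
  ... | no β₀≉0  | _         = let s , β₀s≈1 = inverse β₀ β₀≉0 in _ , proportional-pivot β₀s≈1 α₀β₁≈α₁β₀
  ... | yes _    | no β₁≉0   = let s , β₁s≈1 = inverse β₁ β₁≉0
                                   α₁≈ , α₀≈ = proportional-pivot β₁s≈1 (sym α₀β₁≈α₁β₀)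
                               in _ , α₀≈ , α₁≈

  det : Vector Carrier 2 → Vector Carrier 2 → Carrier
  det α β = α fz * β (fs fz) - α (fs fz) * β fz

  SamePoint-resp : ∀ {u u′ v v′} → u ≈v u′ → v ≈v v′ → SamePoint u′ v′ → SamePoint u v
  SamePoint-resp u≈u′ v≈v′ (a , u′≈av′) = a , λ i → trans (u≈u′ i) (trans (u′≈av′ i) (*-cong refl (sym (v≈v′ i))))

  det≈0⇒SamePoint : ∀ (w : Fin 2 → V) α β → det α β ≈ 0# → NonZero (comb β w) →
                    SamePoint (comb α w) (comb β w)
  det≈0⇒SamePoint w α β det≈0 βw≉0 = a , λ i → begin
    comb α w i                   ≈⟨ comb-cong {a = α} {b = λ j → a * β j} w (λ { fz → α₀≈aβ₀ ; (fs fz) → α₁≈aβ₁ }) i ⟩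
    comb (λ j → a * β j) w i     ≈⟨ Σ'-cong {2} (λ j → *-assoc a (β j) (w j i)) ⟩
    Σ' (λ j → a * (β j * w j i)) ≈⟨ *-distribˡ-Σ' {2} a (λ j → β j * w j i) ⟨
    a * comb β w i               ∎
    where
    β≉0 : ¬ (β fz ≈ 0# × β (fs fz) ≈ 0#)
    β≉0 (β₀≈0 , β₁≈0) = βw≉0 (comb-zero {a = β} w λ { fz → β₀≈0 ; (fs fz) → β₁≈0 })
    proportionality = proportional (x∙y⁻¹≈ε⇒x≈y _ _ det≈0) β≉0
    a = proj₁ proportionality
    α₀≈aβ₀ = proj₁ (proj₂ proportionality)
    α₁≈aβ₁ = proj₂ (proj₂ proportionality)

  cramer : ∀ (w : Fin 2 → V) α β {t} → det α β * t ≈ 1# → ∀ i →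
           w fz i ≈ t * (β (fs fz) * comb α w i + (- α (fs fz)) * comb β w i) ×
           w (fs fz) i ≈ t * (α fz * comb β w i + (- β fz) * comb α w i)
  cramer w α β {t} Dt≈1 i =
    (begin
      w₀                                   ≈⟨ sym (*-identityˡ w₀) ⟩
      1# * w₀                              ≈⟨ *-cong (sym Dt≈1) refl ⟩
      (det α β * t) * w₀                   ≈⟨ solve 7 (λ t α₀ α₁ β₀ β₁ x y →
                                                 ((α₀ :* β₁ :- α₁ :* β₀) :* t) :* x :=
                                                 t :* (β₁ :* (α₀ :* x :+ (α₁ :* y :+ con (+ 0))) :+
                                                       (:- α₁) :* (β₀ :* x :+ (β₁ :* y :+ con (+ 0)))))
                                              refl t (α fz) (α (fs fz)) (β fz) (β (fs fz)) w₀ w₁ ⟩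
      t * (β (fs fz) * comb α w i + (- α (fs fz)) * comb β w i) ∎) ,
    (begin
      w₁                                   ≈⟨ sym (*-identityˡ w₁) ⟩
      1# * w₁                              ≈⟨ *-cong (sym Dt≈1) refl ⟩
      (det α β * t) * w₁                   ≈⟨ solve 7 (λ t α₀ α₁ β₀ β₁ x y →
                                                 ((α₀ :* β₁ :- α₁ :* β₀) :* t) :* y :=
                                                 t :* (α₀ :* (β₀ :* x :+ (β₁ :* y :+ con (+ 0))) :+
                                                       (:- β₀) :* (α₀ :* x :+ (α₁ :* y :+ con (+ 0)))))
                                              refl t (α fz) (α (fs fz)) (β fz) (β (fs fz)) w₀ w₁ ⟩
      t * (α fz * comb β w i + (- β fz) * comb α w i) ∎)
    where
    w₀ = w fz i
    w₁ = w (fs fz) i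

  ⊆span-through-two-points : ∀ (A : Line) {g} (G : Fin g → V) {u v} → u ∈ₚ A → v ∈ₚ A →
                             ¬ SamePoint u v → InSpan u G → InSpan v G → A ⊆span G
  ⊆span-through-two-points A G (_ , α , u≈αA) (v≉0 , β , v≈βA) u≁v u∈G v∈G with det α β ≟ 0#
  ... | yes det≈0 = ⊥-elim (u≁v (SamePoint-resp u≈αA v≈βA (det≈0⇒SamePoint (basis A) α β det≈0 βA≉0)))
    where
    βA≉0 : NonZero (comb β (basis A))
    βA≉0 βA≈0 = v≉0 (λ i → trans (v≈βA i) (βA≈0 i))
  ... | no det≉0 with inverse _ det≉0
  ... | t , Dt≈1 = λ
    { fz      → InSpan-resp G (λ i → sym (proj₁ (cramer (basis A) α β Dt≈1 i)))
                  (InSpan-* G t (InSpan-+ G (InSpan-* G (β (fs fz)) αA∈G) (InSpan-* G (- α (fs fz)) βA∈G)))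
    ; (fs fz) → InSpan-resp G (λ i → sym (proj₂ (cramer (basis A) α β Dt≈1 i)))
                  (InSpan-* G t (InSpan-+ G (InSpan-* G (α fz) βA∈G) (InSpan-* G (- β fz) αA∈G))) }
    where
    αA∈G = InSpan-resp G u≈αA u∈G
    βA∈G = InSpan-resp G v≈βA v∈G

  ⊆span-∷-through-point : ∀ (A : Line) {g} (G : Fin g → V) (a : Vector Carrier 2) →
                          NonZero (comb a (basis A)) → InSpan (comb a (basis A)) G →
                          ∃ λ w → A ⊆span (w ∷ᵛ G)
  ⊆span-∷-through-point A G a aA≉0 aA∈G with a (fs fz) ≟ 0#
  ... | no a₁≉0 with inverse _ a₁≉0
  ...   | s , a₁s≈1 = A₀ , λ
    { fz      → InSpan-member (A₀ ∷ᵛ G) fz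
    ; (fs fz) → InSpan-resp (A₀ ∷ᵛ G) A₁≈
                  (InSpan-* (A₀ ∷ᵛ G) s (InSpan-+ (A₀ ∷ᵛ G) (InSpan-∷ G A₀ aA∈G)
                                                          (InSpan-* (A₀ ∷ᵛ G) (- a fz) (InSpan-member (A₀ ∷ᵛ G) fz)))) }
    where
    A₀ = basis A fz
    A₁≈ : ∀ i → s * (comb a (basis A) i + (- a fz) * A₀ i) ≈ basis A (fs fz) i
    A₁≈ i = begin
      s * (comb a (basis A) i + (- a fz) * A₀ i)
        ≈⟨ solve 5 (λ s a₀ a₁ x y → s :* ((a₀ :* x :+ (a₁ :* y :+ con (+ 0))) :+ (:- a₀) :* x) := (a₁ :* s) :* y)
                   refl s (a fz) (a (fs fz)) (A₀ i) (basis A (fs fz) i) ⟩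
      (a (fs fz) * s) * basis A (fs fz) i ≈⟨ *-cong a₁s≈1 refl ⟩
      1# * basis A (fs fz) i              ≈⟨ *-identityˡ _ ⟩
      basis A (fs fz) i                   ∎
  ⊆span-∷-through-point A G a aA≉0 aA∈G | yes a₁≈0 with a fz ≟ 0#
  ... | yes a₀≈0 = ⊥-elim (aA≉0 (comb-zero {a = a} (basis A) λ { fz → a₀≈0 ; (fs fz) → a₁≈0 }))
  ... | no a₀≉0 with inverse _ a₀≉0
  ...   | s , a₀s≈1 = A₁ , λ
    { fz      → InSpan-resp (A₁ ∷ᵛ G) A₀≈ (InSpan-* (A₁ ∷ᵛ G) s (InSpan-∷ G A₁ aA∈G))
    ; (fs fz) → InSpan-member (A₁ ∷ᵛ G) fz }
    where
    A₁ = basis A (fs fz)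
    A₀≈ : ∀ i → s * comb a (basis A) i ≈ basis A fz i
    A₀≈ i = begin
      s * comb a (basis A) i               ≈⟨ *-cong refl (+-cong refl (+-cong (*-cong a₁≈0 refl) refl)) ⟩
      s * (a fz * basis A fz i + (0# * A₁ i + 0#))
        ≈⟨ solve 4 (λ s a₀ x y → s :* (a₀ :* x :+ (con (+ 0) :* y :+ con (+ 0))) := (a₀ :* s) :* x)
                   refl s (a fz) (basis A fz i) (A₁ i) ⟩
      (a fz * s) * basis A fz i            ≈⟨ *-cong a₀s≈1 refl ⟩
      1# * basis A fz i                    ≈⟨ *-identityˡ _ ⟩
      basis A fz i                         ∎

  ⊆span⇒2≤ : ∀ (A : Line) {b} (B : Fin b → V) → A ⊆span B → 2 ≤ b
  ⊆span⇒2≤ A {zero} B A⊆B = ⊥-elim (basis-nonZero A fz (proj₂ (A⊆B fz)))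
  ⊆span⇒2≤ A {suc zero} B A⊆B = ⊥-elim (basis-nonZero A (fs fz) A₁≈0)
    where
    x = proj₁ (A⊆B fz) fz
    y = proj₁ (A⊆B (fs fz)) fz
    A₀≈xB = proj₂ (A⊆B fz)
    A₁≈yB = proj₂ (A⊆B (fs fz))
    dependence : IsZero (comb (y ∷ᵛ (- x) ∷ᵛ []ᵛ) (basis A))
    dependence i = begin
      y * basis A fz i + ((- x) * basis A (fs fz) i + 0#)
        ≈⟨ +-cong (*-cong refl (A₀≈xB i)) (+-cong (*-cong refl (A₁≈yB i)) refl) ⟩
      y * (x * B fz i + 0#) + ((- x) * (y * B fz i + 0#) + 0#)
        ≈⟨ solve 3 (λ x y b → y :* (x :* b :+ con (+ 0)) :+ ((:- x) :* (y :* b :+ con (+ 0)) :+ con (+ 0))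
                              := con (+ 0)) refl x y (B fz i) ⟩
      0# ∎
    y≈0 : y ≈ 0#
    y≈0 = indep A (y ∷ᵛ (- x) ∷ᵛ []ᵛ) dependence fz
    A₁≈0 : IsZero (basis A (fs fz))
    A₁≈0 i = trans (A₁≈yB i) (trans (+-cong (*-cong y≈0 refl) refl) (trans (+-identityʳ _) (zeroˡ _)))
  ⊆span⇒2≤ A {suc (suc b)} B A⊆B = s≤s (s≤s z≤n)

  ⊆span? : ∀ {k g} (A : Flat k) (G : Fin g → V) → Dec (A ⊆span G)
  ⊆span? A G = Fin.all? (λ j → InSpan? (basis A j) G)

  Meets : ∀ {g} → Line → (Fin g → V) → Set (c ⊔ ℓ)
  Meets A G = Σ (Vector Carrier 2) λ a → NonZero (comb a (basis A)) × InSpan (comb a (basis A)) G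

  Meets? : ∀ {g} (A : Line) (G : Fin g → V) → Dec (Meets A G)
  Meets? A G = ∃ⱽ? 2 _
    (λ {a} {b} a≈b (aA≉0 , aA∈G) →
       (λ bA≈0 → aA≉0 (λ i → trans (comb-cong (basis A) a≈b i) (bA≈0 i))) ,
       InSpan-resp G (comb-cong (basis A) a≈b) aA∈G)
    (λ a → NonZero? (comb a (basis A)) ×-dec InSpan? (comb a (basis A)) G)

  ∈ₚ⇒Meets : ∀ {A : Line} {g} (G : Fin g → V) {x} → x ∈ₚ A → InSpan x G → Meets A G
  ∈ₚ⇒Meets G (x≉0 , a , x≈aA) x∈G = a , (λ aA≈0 → x≉0 (λ i → trans (x≈aA i) (aA≈0 i))) , InSpan-resp G x≈aA x∈G

module GreedyCover {c ℓ} (F : Field c ℓ) {q : ℕ} (card : HasCardinality F q) (n : ℕ)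
                   {m : ℕ} (L : Fin m → Projective.Line F n) where
  open Projective F n
  open Spans F n
  open Geometry F card n

  remove : Fin m → List (Fin m) → List (Fin m)
  remove l = filter (λ j → ¬? (j Fin.≟ l))

  ∈-remove⁺ : ∀ {j l T} → j ∈ T → ¬ j ≡ l → j ∈ remove l T
  ∈-remove⁺ {l = l} = ∈-filter⁺ (λ j → ¬? (j Fin.≟ l))

  ∈-remove⁻ : ∀ {j l T} → j ∈ remove l T → j ∈ T
  ∈-remove⁻ {l = l} = proj₁ ∘ ∈-filter⁻ (λ j → ¬? (j Fin.≟ l))

  length-remove : ∀ {l T} → l ∈ T → length (remove l T) < length T
  length-remove {l} {T} l∈T = filter-notAll (λ j → ¬? (j Fin.≟ l)) T (lose l∈T (λ l≢l → l≢l ≡.refl))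

  Anchored : ∀ {k} → (Fin k → V) → List (Fin m) → Fin m → V → Set (c ⊔ ℓ)
  Anchored G T l y = InSpan y G ⊎ ∃ λ j → j ∈ T × ¬ j ≡ l × y ∈ₛ L j

  DoublyAnchored : ∀ {k} → (Fin k → V) → List (Fin m) → Set (c ⊔ ℓ)
  DoublyAnchored G T = ∀ {l} → l ∈ T → ∃ λ y → ∃ λ y′ →
    y ∈ₚ L l × y′ ∈ₚ L l × ¬ SamePoint y y′ × Anchored G T l y × Anchored G T l y′

  DoublyAnchored-remove : ∀ {k k′} {G : Fin k → V} {G′ : Fin k′ → V} {T l} →
    (∀ t → InSpan (G t) G′) → L l ⊆span G′ → DoublyAnchored G T → DoublyAnchored G′ (remove l T)
  DoublyAnchored-remove {G = G} {G′} {T} {l} G⊆G′ Lₗ⊆G′ anchored l′∈ =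
    let y , y′ , y∈ , y′∈ , y≁y′ , a , a′ = anchored (∈-remove⁻ l′∈) in
    y , y′ , y∈ , y′∈ , y≁y′ , reanchor a , reanchor a′
    where
    reanchor : ∀ {l′ z} → Anchored G T l′ z → Anchored G′ (remove l T) l′ z
    reanchor (inj₁ z∈G) = inj₁ (InSpan-trans G⊆G′ z∈G)
    reanchor (inj₂ (j , j∈T , j≢l′ , z∈Lⱼ)) with j Fin.≟ l
    ... | yes ≡.refl = inj₁ (InSpan-trans Lₗ⊆G′ z∈Lⱼ)
    ... | no j≢l     = inj₂ (j , ∈-remove⁺ j∈T j≢l , j≢l′ , z∈Lⱼ)

  remove-meets : ∀ {k′} {G′ : Fin k′ → V} {T l y} → L l ⊆span G′ → y ∈ₚ L l →
                 (∃ λ j → j ∈ T × ¬ j ≡ l × y ∈ₛ L j) → Any (λ j → Meets (L j) G′) (remove l T)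
  remove-meets {G′ = G′} Lₗ⊆G′ (y≉0 , y∈Lₗ) (j , j∈T , j≢l , y∈Lⱼ) =
    lose (∈-remove⁺ j∈T j≢l) (∈ₚ⇒Meets {L j} G′ (y≉0 , y∈Lⱼ) (InSpan-trans Lₗ⊆G′ y∈Lₗ))

  remove-meets-if-uncovered : ∀ {k k′} {G : Fin k → V} {G′ : Fin k′ → V} {T l} → l ∈ T →
    DoublyAnchored G T → ¬ (L l ⊆span G) → L l ⊆span G′ → Any (λ j → Meets (L j) G′) (remove l T)
  remove-meets-if-uncovered {G = G} {l = l} l∈T anchored Lₗ⊈G Lₗ⊆G′ with anchored l∈T
  ... | y , y′ , y∈ , y′∈ , y≁y′ , inj₂ y-elsewhere , _ = remove-meets Lₗ⊆G′ y∈ y-elsewhere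
  ... | y , y′ , y∈ , y′∈ , y≁y′ , inj₁ _ , inj₂ y′-elsewhere = remove-meets Lₗ⊆G′ y′∈ y′-elsewhere
  ... | y , y′ , y∈ , y′∈ , y≁y′ , inj₁ y∈G , inj₁ y′∈G =
    ⊥-elim (Lₗ⊈G (⊆span-through-two-points (L l) G y∈ y′∈ y≁y′ y∈G y′∈G))

  record Cover (r : ℕ) {k} (G : Fin k → V) (T : List (Fin m)) : Set (c ⊔ ℓ) where
    field
      gens    : Fin r → V
      spans-G : ∀ t → InSpan (G t) gens
      spans-T : ∀ {l} → l ∈ T → L l ⊆span gens

  cover-remove : ∀ {r k k′} {G : Fin k → V} {G′ : Fin k′ → V} {T l} → l ∈ T →
    (∀ t → InSpan (G t) G′) → L l ⊆span G′ → Cover r G′ (remove l T) → Cover r G T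
  cover-remove {T = T} {l} l∈T G⊆G′ Lₗ⊆G′ C = record
    { gens    = gens
    ; spans-G = λ t → InSpan-trans spans-G (G⊆G′ t)
    ; spans-T = λ {l′} → covers l′ }
    where
    open Cover C
    covers : ∀ l′ → l′ ∈ T → L l′ ⊆span gens
    covers l′ l′∈T with l′ Fin.≟ l
    ... | yes ≡.refl = ⊆span-trans {A = L l} Lₗ⊆G′ spans-G
    ... | no l′≢l    = spans-T (∈-remove⁺ l′∈T l′≢l)

  EconomicalCover : ∀ {k} → (Fin k → V) → List (Fin m) → Set (c ⊔ ℓ)
  EconomicalCover {k} G T = ∃ λ r → Cover r G T × r ≤ k Nat.+ length T ×
                                    (Any (λ l → Meets (L l) G) T → r < k Nat.+ length T)

  -- Lines already spanned cost nothing, lines meeting the span cost one vector, and a line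
  -- costing two vectors leaves a remaining line meeting the span, which then costs one.
  greedy-cover : ∀ {k} (G : Fin k → V) T → Acc _<_ (length T) → DoublyAnchored G T → EconomicalCover G T
  greedy-cover {k} G [] _ _ =
    k , record { gens = G ; spans-G = InSpan-member G ; spans-T = λ () } , ℕₚ.m≤m+n k 0 , λ ()
  greedy-cover {k} G T@(x ∷ _) (acc smaller) anchored with any? (λ l → ⊆span? (L l) G) T
  ... | yes some-covered =
    let l , l∈T , Lₗ⊆G = find some-covered
        r , C , r≤ , _ = greedy-cover G (remove l T) (smaller (length-remove l∈T))
                                      (DoublyAnchored-remove (InSpan-member G) Lₗ⊆G anchored)
        r< = ℕₚ.≤-<-trans r≤ (ℕₚ.+-monoʳ-< k (length-remove l∈T))
    in r , cover-remove l∈T (InSpan-member G) Lₗ⊆G C , ℕₚ.<⇒≤ r< , λ _ → r<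
  ... | no none-covered with any? (λ l → Meets? (L l) G) T
  ...   | yes some-meets =
    let l , l∈T , a , aLₗ≉0 , aLₗ∈G = find some-meets
        w , Lₗ⊆G′ = ⊆span-∷-through-point (L l) G a aLₗ≉0 aLₗ∈G
        G⊆G′ = λ t → InSpan-∷ G w (InSpan-member G t)
        r , C , _ , r<′ = greedy-cover (w ∷ᵛ G) (remove l T) (smaller (length-remove l∈T))
                                       (DoublyAnchored-remove {G′ = w ∷ᵛ G} G⊆G′ Lₗ⊆G′ anchored)
        r< = ℕₚ.≤-<-trans (Nat.s≤s⁻¹ (r<′ (remove-meets-if-uncovered {G′ = w ∷ᵛ G} l∈T anchored
                                                (none-covered ∘ lose l∈T) Lₗ⊆G′)))
                           (ℕₚ.+-monoʳ-< k (length-remove l∈T))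
    in r , cover-remove {G′ = w ∷ᵛ G} l∈T G⊆G′ Lₗ⊆G′ C , ℕₚ.<⇒≤ r< , λ _ → r<
  ...   | no none-meets =
    let x∈T = here ≡.refl
        r , C , _ , r<′ = greedy-cover G′ (remove x T) (smaller (length-remove x∈T))
                                       (DoublyAnchored-remove {G′ = G′} G⊆G′ Lₓ⊆G′ anchored)
        r≤ = ℕₚ.≤-trans (Nat.s≤s⁻¹ (r<′ (remove-meets-if-uncovered {G′ = G′} x∈T anchored
                                               (none-covered ∘ lose x∈T) Lₓ⊆G′)))
                        (ℕₚ.≤-reflexive (≡.sym (ℕₚ.+-suc k _)))
    in r , cover-remove {G′ = G′} x∈T G⊆G′ Lₓ⊆G′ C ,
       ℕₚ.≤-trans r≤ (ℕₚ.+-monoʳ-≤ k (length-remove x∈T)) , ⊥-elim ∘ none-meets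
    where
    A₀ = basis (L x) fz
    A₁ = basis (L x) (fs fz)
    G′ = A₁ ∷ᵛ A₀ ∷ᵛ G
    G⊆G′ : ∀ t → InSpan (G t) G′
    G⊆G′ t = InSpan-∷ (A₀ ∷ᵛ G) A₁ (InSpan-∷ G A₀ (InSpan-member G t))
    Lₓ⊆G′ : L x ⊆span G′
    Lₓ⊆G′ fz      = InSpan-∷ (A₀ ∷ᵛ G) A₁ (InSpan-member (A₀ ∷ᵛ G) fz)
    Lₓ⊆G′ (fs fz) = InSpan-member G′ fz

module Crossings {c ℓ} (F : Field c ℓ) {q : ℕ} (card : HasCardinality F q) (n : ℕ)
                 {m : ℕ} (L : Fin m → Projective.Line F n) where
  open Field F using (Carrier; refl; trans)
  open Projective F n
  open Spans F n
  open Geometry F card n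
  open FiniteField F card using (∃ⱽ?)

  Crossing : Fin m → V → Set (c ⊔ ℓ)
  Crossing j x = x ∈ₚ L j × ∃ λ j′ → ¬ j′ ≡ j × x ∈ₛ L j′

  module _ (j : Fin m) (ps : List V) where
    private
      onLine : Vector Carrier 2 → V
      onLine a = comb a (basis (L j))

      New : V → Set (c ⊔ ℓ)
      New x = NonZero x × (∃ λ j′ → ¬ j′ ≡ j × x ∈ₛ L j′) × All (λ p → ¬ SamePoint x p) ps

      New-resp : ∀ {u v} → u ≈v v → New u → New v
      New-resp u≈v (u≉0 , (j′ , j′≢j , u∈Lⱼ′) , new) =
        (λ v≈0 → u≉0 (λ i → trans (u≈v i) (v≈0 i))) ,
        (j′ , j′≢j , InSpan-resp (basis (L j′)) u≈v u∈Lⱼ′) ,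
        All.map (λ u≁p v∼p → u≁p (SamePoint-resp u≈v (λ _ → refl) v∼p)) new

      New? : ∀ x → Dec (New x)
      New? x = NonZero? x ×-dec Fin.any? (λ j′ → ¬? (j′ Fin.≟ j) ×-dec InSpan? x (basis (L j′)))
                          ×-dec All.all? (λ p → ¬? (SamePoint? x p)) ps

    crossing-among-or-new :
      (∀ x → Crossing j x → Any (SamePoint x) ps) ⊎ (∃ λ x → Crossing j x × All (λ p → ¬ SamePoint x p) ps)
    crossing-among-or-new with ∃ⱽ? 2 (New ∘ onLine) (New-resp ∘ comb-cong (basis (L j))) (New? ∘ onLine)
    ... | yes (a , x≉0 , other , new) = inj₂ (onLine a , ((x≉0 , a , λ _ → refl) , other) , new)
    ... | no no-new = inj₁ among
      where
      among : ∀ x → Crossing j x → Any (SamePoint x) ps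
      among x ((x≉0 , a , x≈aL) , other) with any? (SamePoint? x) ps
      ... | yes x∼ps = x∼ps
      ... | no x≁ps  = ⊥-elim (no-new (a , New-resp x≈aL (x≉0 , other , ¬Any⇒All¬ ps x≁ps)))

  CrossingsWithin : Fin m → V → V → Set (c ⊔ ℓ)
  CrossingsWithin j p p′ = p ∈ₚ L j × p′ ∈ₚ L j ×
    (∀ j′ → ¬ (j′ ≡ j) → ∀ x → x ∈ₚ L j → x ∈ₚ L j′ → SamePoint x p ⊎ SamePoint x p′)

  ThreeCrossings : Fin m → Set (c ⊔ ℓ)
  ThreeCrossings j = ∃ λ y₁ → ∃ λ y₂ → ∃ λ y₃ → Crossing j y₁ × Crossing j y₂ × Crossing j y₃ ×
                     ¬ SamePoint y₂ y₁ × ¬ SamePoint y₃ y₁ × ¬ SamePoint y₃ y₂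

  private
    crossings-within : ∀ {j p p′} → p ∈ₚ L j → p′ ∈ₚ L j →
      (∀ x → Crossing j x → SamePoint x p ⊎ SamePoint x p′) → CrossingsWithin j p p′
    crossings-within p∈ p′∈ among = p∈ , p′∈ , λ j′ j′≢j x x∈Lⱼ x∈Lⱼ′ → among x (x∈Lⱼ , j′ , j′≢j , proj₂ x∈Lⱼ′)

  two-points-or-three-crossings : ∀ j → (∃ λ p → ∃ λ p′ → CrossingsWithin j p p′) ⊎ ThreeCrossings j
  two-points-or-three-crossings j with crossing-among-or-new j []
  ... | inj₁ none = inj₁ (A₀ , A₀ , crossings-within A₀∈ A₀∈ λ x c → case none x c of λ ())
    where
    A₀ = basis (L j) fz
    A₀∈ : A₀ ∈ₚ L j
    A₀∈ = basis-nonZero (L j) fz , InSpan-member (basis (L j)) fz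
  ... | inj₂ (y₁ , c₁ , []) with crossing-among-or-new j (y₁ ∷ [])
  ...   | inj₁ among = inj₁ (y₁ , y₁ , crossings-within (proj₁ c₁) (proj₁ c₁) λ x c → case among x c of λ
    { (here x∼y₁) → inj₁ x∼y₁ })
  ...   | inj₂ (y₂ , c₂ , y₂≁y₁ ∷ []) with crossing-among-or-new j (y₁ ∷ y₂ ∷ [])
  ...     | inj₁ among = inj₁ (y₁ , y₂ , crossings-within (proj₁ c₁) (proj₁ c₂) λ x c → case among x c of λ
    { (here x∼y₁) → inj₁ x∼y₁ ; (there (here x∼y₂)) → inj₂ x∼y₂ })
  ...     | inj₂ (y₃ , c₃ , y₃≁y₁ ∷ y₃≁y₂ ∷ []) = inj₂ (y₁ , y₂ , y₃ , c₁ , c₂ , c₃ , y₂≁y₁ , y₃≁y₁ , y₃≁y₂)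

  module _ (distinct : ∀ i j → SameFlat (L i) (L j) → i ≡ j) where

    equal-if-two-common-points : ∀ {j j′ y y′} → y ∈ₚ L j → y′ ∈ₚ L j → y ∈ₛ L j′ → y′ ∈ₛ L j′ →
                                 ¬ SamePoint y y′ → j ≡ j′
    equal-if-two-common-points {j} {j′} y∈Lⱼ y′∈Lⱼ y∈Lⱼ′ y′∈Lⱼ′ y≁y′ = distinct j j′
      ( ⊆span-through-two-points (L j) (basis (L j′)) y∈Lⱼ y′∈Lⱼ y≁y′ y∈Lⱼ′ y′∈Lⱼ′
      , ⊆span-through-two-points (L j′) (basis (L j)) (proj₁ y∈Lⱼ , y∈Lⱼ′) (proj₁ y′∈Lⱼ , y′∈Lⱼ′) y≁y′
                                 (proj₂ y∈Lⱼ) (proj₂ y′∈Lⱼ))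

    CrossingAvoiding : Fin m → Fin m → V → Set (c ⊔ ℓ)
    CrossingAvoiding j₀ l y = ∃ λ j → ¬ j ≡ j₀ × ¬ j ≡ l × y ∈ₛ L j

    two-crossings-avoiding : ∀ {l j₀} → ¬ l ≡ j₀ → ThreeCrossings l → ∃ λ y → ∃ λ y′ →
      y ∈ₚ L l × y′ ∈ₚ L l × ¬ SamePoint y y′ × CrossingAvoiding j₀ l y × CrossingAvoiding j₀ l y′
    two-crossings-avoiding {l} {j₀} l≢j₀
      (y₁ , y₂ , y₃ , (y₁∈ , j₁ , j₁≢l , y₁∈Lⱼ₁) , (y₂∈ , j₂ , j₂≢l , y₂∈Lⱼ₂) , (y₃∈ , j₃ , j₃≢l , y₃∈Lⱼ₃) ,
       y₂≁y₁ , y₃≁y₁ , y₃≁y₂)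
      with j₁ Fin.≟ j₀ | j₂ Fin.≟ j₀ | j₃ Fin.≟ j₀
    ... | no j₁≢j₀   | no j₂≢j₀   | _ =
      y₂ , y₁ , y₂∈ , y₁∈ , y₂≁y₁ , (j₂ , j₂≢j₀ , j₂≢l , y₂∈Lⱼ₂) , (j₁ , j₁≢j₀ , j₁≢l , y₁∈Lⱼ₁)
    ... | no j₁≢j₀   | yes _      | no j₃≢j₀ =
      y₃ , y₁ , y₃∈ , y₁∈ , y₃≁y₁ , (j₃ , j₃≢j₀ , j₃≢l , y₃∈Lⱼ₃) , (j₁ , j₁≢j₀ , j₁≢l , y₁∈Lⱼ₁)
    ... | yes _      | no j₂≢j₀   | no j₃≢j₀ =
      y₃ , y₂ , y₃∈ , y₂∈ , y₃≁y₂ , (j₃ , j₃≢j₀ , j₃≢l , y₃∈Lⱼ₃) , (j₂ , j₂≢j₀ , j₂≢l , y₂∈Lⱼ₂)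
    ... | yes ≡.refl | yes ≡.refl | _ = ⊥-elim (l≢j₀ (equal-if-two-common-points y₂∈ y₁∈ y₂∈Lⱼ₂ y₁∈Lⱼ₁ y₂≁y₁))
    ... | yes ≡.refl | no _       | yes ≡.refl = ⊥-elim (l≢j₀ (equal-if-two-common-points y₃∈ y₁∈ y₃∈Lⱼ₃ y₁∈Lⱼ₁ y₃≁y₁))
    ... | no _       | yes ≡.refl | yes ≡.refl = ⊥-elim (l≢j₀ (equal-if-two-common-points y₃∈ y₂∈ y₃∈Lⱼ₃ y₂∈Lⱼ₂ y₃≁y₂))

module ThreeCrossingsEverywhere {c ℓ} (F : Field c ℓ) {q : ℕ} (card : HasCardinality F q) (n : ℕ)
  {m′ : ℕ} (L : Fin (suc m′) → Projective.Line F n) (m′≤n : m′ ≤ n)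
  (distinct : ∀ i j → Projective.SameFlat F n (L i) (L j) → i ≡ j)
  (general : Projective.GeneralPosition F n L) where
  open Projective F n
  open Spans F n
  open Geometry F card n
  open GreedyCover F card n L
  open Crossings F card n L

  others : List (Fin (suc m′))
  others = tabulate fs

  ∈-others⁺ : ∀ {j} → ¬ j ≡ fz → j ∈ others
  ∈-others⁺ {fz}   j≢fz = ⊥-elim (j≢fz ≡.refl)
  ∈-others⁺ {fs j} _    = ∈-tabulate⁺ j

  ∈-others⁻ : ∀ {j} → j ∈ others → ¬ j ≡ fz
  ∈-others⁻ j∈ with ∈-tabulate⁻ j∈
  ... | _ , ≡.refl = λ ()

  others-doubly-anchored : (∀ j → ThreeCrossings j) → DoublyAnchored []ᵛ others
  others-doubly-anchored three {l} l∈ =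
    let y , y′ , y∈ , y′∈ , y≁y′ , off , off′ = two-crossings-avoiding distinct (∈-others⁻ l∈) (three l)
    in y , y′ , y∈ , y′∈ , y≁y′ , anchor off , anchor off′
    where
    anchor : ∀ {y} → CrossingAvoiding distinct fz l y → Anchored []ᵛ others l y
    anchor (j , j≢fz , j≢l , y∈Lⱼ) = inj₂ (j , ∈-others⁺ j≢fz , j≢l , y∈Lⱼ)

  not-general : ∀ {b} (B : Fin b → V) → LinIndep B → 2 ≤ b → b ≤ m′ → (∀ {l} → l ∈ others → L l ⊆span B) → ⊥
  not-general {suc (suc d)} B B-indep (s≤s (s≤s z≤n)) b≤m′ others⊆B =
    general (suc d) (s≤s z≤n) (ℕₚ.≤-trans b≤m′ m′≤n) ι ι-injective
            (record { basis = B ; indep = B-indep } , λ i → others⊆B (∈-others⁺ λ ()))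
    where
    ι : Fin (suc (suc d)) → Fin (suc m′)
    ι i = fs (inject≤ i b≤m′)
    ι-injective : ∀ i j → ι i ≡ ι j → i ≡ j
    ι-injective i j ιi≡ιj = inject≤-injective b≤m′ b≤m′ i j (suc-injective ιi≡ιj)

  impossible : (∀ j → ThreeCrossings j) → ⊥
  impossible three =
    let r , C , r≤ , _ = greedy-cover []ᵛ others (<-wellFounded _) (others-doubly-anchored three)
        b , B , b≤r , B-indep , gens⊆B = independent-subfamily (Cover.gens C)
        others⊆B : ∀ {l} → l ∈ others → L l ⊆span B
        others⊆B l∈ = ⊆span-trans {A = L _} (Cover.spans-T C l∈) gens⊆B
        _ , _ , _ , (_ , j , j≢fz , _) , _ = three fz
    in not-general B B-indep (⊆span⇒2≤ (L j) B (others⊆B (∈-others⁺ j≢fz)))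
                   (ℕₚ.≤-trans b≤r (≡.subst (r ≤_) (length-tabulate fs) r≤)) others⊆B

∃-or-∀ : ∀ {a b m} {A : Fin m → Set a} {B : Fin m → Set b} → (∀ j → A j ⊎ B j) → ∃ A ⊎ (∀ j → B j)
∃-or-∀ {m = zero}  _      = inj₂ λ ()
∃-or-∀ {m = suc m} A-or-B with A-or-B fz | ∃-or-∀ (A-or-B ∘ fs)
... | inj₁ a | _              = inj₁ (fz , a)
... | inj₂ _ | inj₁ (j , a)   = inj₁ (fs j , a)
... | inj₂ b | inj₂ bs        = inj₂ λ { fz → b ; (fs j) → bs j }

lemma6p2 : ∀ {c ℓ : Level} (F : Field c ℓ) (q : ℕ) → IsPrimePower q → HasCardinality F q →
    (n : ℕ) → 1 ≤ n →
    let open Projective F n in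
    (m : ℕ) → 1 ≤ m → m ≤ suc n →
    (L : Fin m → Line) →
    (∀ i j → SameFlat (L i) (L j) → i ≡ j) →
    GeneralPosition L →
    ∃[ j ] ∃[ p ] ∃[ p′ ] (p ∈ₚ L j × p′ ∈ₚ L j ×
    (∀ j′ → ¬ (j′ ≡ j) → ∀ x → x ∈ₚ L j → x ∈ₚ L j′ → SamePoint x p ⊎ SamePoint x p′))
lemma6p2 F q _ card n _ (suc m′) _ (s≤s m′≤n) L distinct general
  with ∃-or-∀ (Crossings.two-points-or-three-crossings F card n L)
... | inj₁ (j , p , p′ , within) = j , p , p′ , within
... | inj₂ three-everywhere =
  ⊥-elim (ThreeCrossingsEverywhere.impossible F card n L m′≤n distinct general three-everywhere)
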